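{- Let $v$ be a positive integer and let $(Q,\mathcal{B})$ be a uniform nested SQS$(v)$ in which all $\binom{v}{2}$ pairs of $Q$ are ND-pairs. Then $v \equiv 2 \pmod 6$ and the multiplicity of each pair is $\frac{v-2}{6}$.
   Context: A Steiner quadruple system SQS$(v)$ is a pair $(Q,\mathcal{B})$ where $Q$ is a set of $v$ points and $\mathcal{B}$ is a collection of 4-subsets of $Q$ (blocks) such that every 3-subset of $Q$ is contained in exactly one block. (An SQS$(v)$ exists if and only if $v\ge 4$ and $v\equiv 2$ or $4 \pmod 6$.) A nested SQS$(v)$ is an SQS$(v)$ together with a partition of each block into two 2-subsets (pairs). A pair of points is an ND-pair if it is one of the two pairs in the partition of at least one block; the multiplicity of a pair is the number of blocks whose partition contains that pair. A nested SQS is uniform if all its ND-pairs have the same multiplicity. -}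

module Defs where

open import Data.Nat using (ℕ; _≤_)
open import Data.Fin using (Fin; _≟_)
open import Data.List using (List; filter; length)
open import Data.Product using (_×_; ∃; Σ)
open import Data.Sum using (_⊎_)
open import Relation.Binary.PropositionalEquality using (_≡_; _≢_)
open import Relation.Nullary using (Dec; ¬_)
open import Relation.Nullary.Decidable using (_×-dec_; _⊎-dec_; ¬?)

-- A nested block on the point set Fin v: four distinct points a,b,c,d,
-- forming the block {a,b,c,d} partitioned into the pairs {a,b} and {c,d}.
record NestedBlock (v : ℕ) : Set where
  constructor nb
  field
    a b c d : Fin v
    a≢b : a ≢ b
    a≢c : a ≢ c
    a≢d : a ≢ d
    b≢c : b ≢ c
    b≢d : b ≢ d
    c≢d : c ≢ d
open NestedBlock public

_∈B_ : ∀ {v} → Fin v → NestedBlock v → Set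
x ∈B B = (x ≡ a B) ⊎ (x ≡ b B) ⊎ (x ≡ c B) ⊎ (x ≡ d B)

_∈B?_ : ∀ {v} (x : Fin v) (B : NestedBlock v) → Dec (x ∈B B)
x ∈B? B = (x ≟ a B) ⊎-dec (x ≟ b B) ⊎-dec (x ≟ c B) ⊎-dec (x ≟ d B)

ContainsTriple : ∀ {v} → NestedBlock v → Fin v → Fin v → Fin v → Set
ContainsTriple B x y z = (x ∈B B) × (y ∈B B) × (z ∈B B)

containsTriple? : ∀ {v} (B : NestedBlock v) (x y z : Fin v) → Dec (ContainsTriple B x y z)
containsTriple? B x y z = (x ∈B? B) ×-dec (y ∈B? B) ×-dec (z ∈B? B)

SamePair : ∀ {v} → Fin v → Fin v → Fin v → Fin v → Set
SamePair x y p q = ((x ≡ p) × (y ≡ q)) ⊎ ((x ≡ q) × (y ≡ p))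

samePair? : ∀ {v} (x y p q : Fin v) → Dec (SamePair x y p q)
samePair? x y p q = ((x ≟ p) ×-dec (y ≟ q)) ⊎-dec ((x ≟ q) ×-dec (y ≟ p))

PairOf : ∀ {v} → NestedBlock v → Fin v → Fin v → Set
PairOf B x y = SamePair x y (a B) (b B) ⊎ SamePair x y (c B) (d B)

pairOf? : ∀ {v} (B : NestedBlock v) (x y : Fin v) → Dec (PairOf B x y)
pairOf? B x y = samePair? x y (a B) (b B) ⊎-dec samePair? x y (c B) (d B)

tripleCount : ∀ {v} → List (NestedBlock v) → Fin v → Fin v → Fin v → ℕ
tripleCount ℬ x y z = length (filter (λ B → containsTriple? B x y z) ℬ)

multiplicity : ∀ {v} → List (NestedBlock v) → Fin v → Fin v → ℕ
multiplicity ℬ x y = length (filter (λ B → pairOf? B x y) ℬ)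

-- A nested SQS(v) on the point set Fin v, with blocks given as a list
-- (a multiset; the count condition forbids repetitions of blocks).
-- Following the context, SQS(v) is only considered for v ≥ 4.
IsNestedSQS : (v : ℕ) → List (NestedBlock v) → Set
IsNestedSQS v ℬ =
  (4 ≤ v) ×
  (∀ (x y z : Fin v) → x ≢ y → x ≢ z → y ≢ z → tripleCount ℬ x y z ≡ 1)

IsNDPair : ∀ {v} → List (NestedBlock v) → Fin v → Fin v → Set
IsNDPair ℬ x y = 1 ≤ multiplicity ℬ x y

IsUniform : ∀ {v} → List (NestedBlock v) → Set
IsUniform {v} ℬ = ∃ λ (m : ℕ) →
  ∀ (x y : Fin v) → x ≢ y → IsNDPair ℬ x y → multiplicity ℬ x y ≡ m

{-# OPTIONS --safe #-}
-- Count the ordered triples and the ordered pairs of distinct points, each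
-- against the list of blocks.  Every one of the v(v-1)(v-2) triples lies in
-- exactly one block and every block contains 24 of them, so
-- v(v-1)(v-2) = 24|ℬ|.  Every ordered pair of distinct points is an ND-pair of
-- the common multiplicity m and every block contributes 4 ordered ND-pairs, so
-- v(v-1)m = 4|ℬ|.  Dividing, v - 2 = 6m.
module Submission where

open import Defs
open import Data.Bool.Base using (if_then_else_)
open import Data.Fin using (Fin; zero; suc; _≟_)
open import Data.Fin.Patterns using (0F; 1F; 2F; 3F)
open import Data.List using (List; []; _∷_; filter; length; lookup)
open import Data.Nat using (ℕ; zero; suc; _+_; _*_; _∸_; _%_; _/_; _≤_; s≤s)
open import Data.Nat.DivMod using ([m+kn]%n≡m%n; m*n/n≡m)
open import Data.Nat.Properties
  using (+-*-semiring; +-identityʳ; *-identityʳ; *-comm; *-assoc; +-cancelˡ-≡; *-cancelˡ-≡; suc-injective)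
open import Data.Product using (_×_; _,_; proj₁; proj₂)
open import Data.Product.Function.NonDependent.Propositional using (_×-⇔_)
open import Data.Sum using (inj₁; inj₂; [_,_])
open import Data.Sum.Function.Propositional using (_⊎-⇔_)
open import Function using (_∘_; _⇔_; mk⇔; Equivalence)
open import Function.Definitions using (Injective)
open import Function.Related.TypeIsomorphisms using (¬-cong-⇔)
open import Relation.Binary.PropositionalEquality
  using (_≡_; _≢_; refl; sym; trans; cong; cong₂; module ≡-Reasoning)
open import Relation.Nullary using (Dec; yes; no; does; ¬_; ¬?; contradiction)
open import Relation.Nullary.Decidable using (_×-dec_; _⊎-dec_)

open import Algebra.Properties.Semiring.Sum +-*-semiring
  using (sum; sum-syntax; sum-cong-≗; sum-replicate-zero; ∑-comm; ∑-distrib-+; *-distribˡ-sum; *-distribʳ-sum)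
open ≡-Reasoning

private
  variable
    P Q : Set
    m n : ℕ

𝟙 : Dec P → ℕ
𝟙 P? = if does P? then 1 else 0

𝟙-× : (P? : Dec P) (Q? : Dec Q) → 𝟙 (P? ×-dec Q?) ≡ 𝟙 P? * 𝟙 Q?
𝟙-× (yes _) Q? = sym (+-identityʳ (𝟙 Q?))
𝟙-× (no _)  Q? = refl

𝟙-⊎ : (P? : Dec P) (Q? : Dec Q) → (P → ¬ Q) → 𝟙 (P? ⊎-dec Q?) ≡ 𝟙 P? + 𝟙 Q?
𝟙-⊎ (yes p) (yes q) disjoint = contradiction q (disjoint p)
𝟙-⊎ (yes _) (no _)  _        = refl
𝟙-⊎ (no _)  Q?      _        = refl

𝟙-+-𝟙-¬ : (P? : Dec P) → 𝟙 P? + 𝟙 (¬? P?) ≡ 1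
𝟙-+-𝟙-¬ (yes _) = refl
𝟙-+-𝟙-¬ (no _)  = refl

𝟙-cong : (P? : Dec P) (Q? : Dec Q) → P ⇔ Q → 𝟙 P? ≡ 𝟙 Q?
𝟙-cong (yes _) (yes _) _   = refl
𝟙-cong (yes p) (no ¬q) P⇔Q = contradiction (Equivalence.to P⇔Q p) ¬q
𝟙-cong (no ¬p) (yes q) P⇔Q = contradiction (Equivalence.from P⇔Q q) ¬p
𝟙-cong (no _)  (no _)  _   = refl

𝟙-absorb : (Q? : Dec Q) (P? : Dec P) → (P → Q) → 𝟙 Q? * 𝟙 P? ≡ 𝟙 P?
𝟙-absorb (yes _) P?      _   = +-identityʳ (𝟙 P?)
𝟙-absorb (no ¬q) (yes p) P→Q = contradiction (P→Q p) ¬q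
𝟙-absorb (no _)  (no _)  _   = refl

𝟙-*-cong : (P? : Dec P) → (P → m ≡ n) → 𝟙 P? * m ≡ 𝟙 P? * n
𝟙-*-cong (yes p) m≡n = cong (1 *_) (m≡n p)
𝟙-*-cong (no _)  _   = refl

∑-const : ∀ n c → ∑[ i < n ] c ≡ n * c
∑-const zero    c = refl
∑-const (suc n) c = cong (c +_) (∑-const n c)

∑₂-cong : {f g : Fin m → Fin n → ℕ} → (∀ i j → f i j ≡ g i j) →
          ∑[ i < m ] ∑[ j < n ] f i j ≡ ∑[ i < m ] ∑[ j < n ] g i j
∑₂-cong f≡g = sum-cong-≗ (λ i → sum-cong-≗ (f≡g i))

∑₃-cong : {f g : Fin m → Fin m → Fin m → ℕ} → (∀ i j k → f i j k ≡ g i j k) →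
          ∑[ i < m ] ∑[ j < m ] ∑[ k < m ] f i j k ≡ ∑[ i < m ] ∑[ j < m ] ∑[ k < m ] g i j k
∑₃-cong f≡g = sum-cong-≗ (λ i → ∑₂-cong (f≡g i))

∑₂-comm-∑ : (f : Fin m → Fin m → Fin n → ℕ) →
            ∑[ i < m ] ∑[ j < m ] ∑[ l < n ] f i j l ≡ ∑[ l < n ] ∑[ i < m ] ∑[ j < m ] f i j l
∑₂-comm-∑ f = trans (sum-cong-≗ (λ i → ∑-comm (f i))) (∑-comm (λ i l → ∑[ j < _ ] f i j l))

∑₃-comm-∑ : (f : Fin m → Fin m → Fin m → Fin n → ℕ) →
            ∑[ i < m ] ∑[ j < m ] ∑[ k < m ] ∑[ l < n ] f i j k l ≡
            ∑[ l < n ] ∑[ i < m ] ∑[ j < m ] ∑[ k < m ] f i j k l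
∑₃-comm-∑ f = trans (sum-cong-≗ (λ i → ∑₂-comm-∑ (f i)))
                    (∑-comm (λ i l → ∑[ j < _ ] ∑[ k < _ ] f i j k l))

∑-δ : (p : Fin n) (g : Fin n → ℕ) → ∑[ z < n ] (𝟙 (z ≟ p) * g z) ≡ g p
∑-δ {suc n} zero    g = trans (cong₂ _+_ (+-identityʳ (g zero)) (sum-replicate-zero n)) (+-identityʳ (g zero))
∑-δ {suc n} (suc p) g = ∑-δ p (g ∘ suc)

∑-≟ : (p : Fin n) → ∑[ z < n ] 𝟙 (p ≟ z) ≡ 1
∑-≟ {suc n} zero    = cong suc (sum-replicate-zero n)
∑-≟ {suc n} (suc p) = ∑-≟ p

∑-partition : (f g : Fin n → ℕ) → (∀ z → f z + g z ≡ 1) → sum f + sum g ≡ n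
∑-partition {n} f g f+g≡1 = begin
  sum f + sum g              ≡⟨ ∑-distrib-+ f g ⟨
  ∑[ z < n ] (f z + g z)     ≡⟨ sum-cong-≗ f+g≡1 ⟩
  ∑[ z < n ] 1               ≡⟨ ∑-const n 1 ⟩
  n * 1                      ≡⟨ *-identityʳ n ⟩
  n                          ∎

∑-≢ : (x : Fin (suc n)) → ∑[ z < suc n ] 𝟙 (¬? (x ≟ z)) ≡ n
∑-≢ {n} x = suc-injective (begin
  1 + sum (𝟙 ∘ ¬? ∘ (x ≟_))
    ≡⟨ cong (_+ sum (𝟙 ∘ ¬? ∘ (x ≟_))) (∑-≟ x) ⟨
  sum (𝟙 ∘ (x ≟_)) + sum (𝟙 ∘ ¬? ∘ (x ≟_))
    ≡⟨ ∑-partition (𝟙 ∘ (x ≟_)) (𝟙 ∘ ¬? ∘ (x ≟_)) (𝟙-+-𝟙-¬ ∘ (x ≟_)) ⟩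
  suc n ∎)

∑-≢-≢ : {x y : Fin (2 + n)} → x ≢ y → ∑[ z < 2 + n ] (𝟙 (¬? (x ≟ z)) * 𝟙 (¬? (y ≟ z))) ≡ n
∑-≢-≢ {n} {x} {y} x≢y = +-cancelˡ-≡ 2 _ _ (begin
  2 + sum neither
    ≡⟨ cong (_+ sum neither) (cong₂ _+_ (∑-≟ x) (∑-≟ y)) ⟨
  (sum (𝟙 ∘ (x ≟_)) + sum (𝟙 ∘ (y ≟_))) + sum neither
    ≡⟨ cong (_+ sum neither) (∑-distrib-+ (𝟙 ∘ (x ≟_)) (𝟙 ∘ (y ≟_))) ⟨
  ∑[ z < 2 + n ] (𝟙 (x ≟ z) + 𝟙 (y ≟ z)) + sum neither
    ≡⟨ ∑-partition _ neither partition ⟩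
  2 + n ∎)
  where
  neither : Fin (2 + n) → ℕ
  neither z = 𝟙 (¬? (x ≟ z)) * 𝟙 (¬? (y ≟ z))

  partition : ∀ z → (𝟙 (x ≟ z) + 𝟙 (y ≟ z)) + 𝟙 (¬? (x ≟ z)) * 𝟙 (¬? (y ≟ z)) ≡ 1
  partition z with x ≟ z | y ≟ z
  ... | yes x≡z | yes y≡z = contradiction (trans x≡z (sym y≡z)) x≢y
  ... | yes _   | no _    = refl
  ... | no _    | yes _   = refl
  ... | no _    | no _    = refl

∑-distinct₂ : ∀ c → ∑[ x < suc n ] ∑[ y < suc n ] (𝟙 (¬? (x ≟ y)) * c) ≡ suc n * (n * c)
∑-distinct₂ {n} c = trans (sum-cong-≗ row) (∑-const (suc n) (n * c))
  where
  row : ∀ x → ∑[ y < suc n ] (𝟙 (¬? (x ≟ y)) * c) ≡ n * c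
  row x = trans (sym (*-distribʳ-sum c (λ y → 𝟙 (¬? (x ≟ y))))) (cong (_* c) (∑-≢ x))

Distinct₃ : Fin n → Fin n → Fin n → Set
Distinct₃ x y z = x ≢ y × x ≢ z × y ≢ z

distinct₃? : (x y z : Fin n) → Dec (Distinct₃ x y z)
distinct₃? x y z = ¬? (x ≟ y) ×-dec ¬? (x ≟ z) ×-dec ¬? (y ≟ z)

∑-distinct₃ : ∑[ x < 2 + n ] ∑[ y < 2 + n ] ∑[ z < 2 + n ] 𝟙 (distinct₃? x y z) ≡ (2 + n) * (suc n * n)
∑-distinct₃ {n} = trans (∑₂-cong column) (∑-distinct₂ {suc n} n)
  where
  column : ∀ x y → ∑[ z < 2 + n ] 𝟙 (distinct₃? x y z) ≡ 𝟙 (¬? (x ≟ y)) * n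
  column x y = begin
    ∑[ z < 2 + n ] 𝟙 (distinct₃? x y z)
      ≡⟨ sum-cong-≗ (λ z → trans (𝟙-× (¬? (x ≟ y)) (¬? (x ≟ z) ×-dec ¬? (y ≟ z)))
                                  (cong (𝟙 (¬? (x ≟ y)) *_) (𝟙-× (¬? (x ≟ z)) (¬? (y ≟ z))))) ⟩
    ∑[ z < 2 + n ] (𝟙 (¬? (x ≟ y)) * (𝟙 (¬? (x ≟ z)) * 𝟙 (¬? (y ≟ z))))
      ≡⟨ *-distribˡ-sum (𝟙 (¬? (x ≟ y))) (λ z → 𝟙 (¬? (x ≟ z)) * 𝟙 (¬? (y ≟ z))) ⟨
    𝟙 (¬? (x ≟ y)) * ∑[ z < 2 + n ] (𝟙 (¬? (x ≟ z)) * 𝟙 (¬? (y ≟ z)))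
      ≡⟨ 𝟙-*-cong (¬? (x ≟ y)) ∑-≢-≢ ⟩
    𝟙 (¬? (x ≟ y)) * n ∎

length-filter≡∑ : {A : Set} {P : A → Set} (P? : ∀ x → Dec (P x)) (xs : List A) →
                  length (filter P? xs) ≡ ∑[ i < length xs ] 𝟙 (P? (lookup xs i))
length-filter≡∑ P? []       = refl
length-filter≡∑ P? (x ∷ xs) with P? x
... | yes _ = cong suc (length-filter≡∑ P? xs)
... | no _  = length-filter≡∑ P? xs

module _ {m n : ℕ} {f : Fin m → Fin n} (f-injective : Injective _≡_ _≡_ f) where

  ≡-injective : {x y : Fin m} → (f x ≡ f y) ⇔ (x ≡ y)
  ≡-injective = mk⇔ f-injective (cong f)

  distinct₃-injective : {x y z : Fin m} → Distinct₃ (f x) (f y) (f z) ⇔ Distinct₃ x y z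
  distinct₃-injective = ¬-cong-⇔ ≡-injective ×-⇔ ¬-cong-⇔ ≡-injective ×-⇔ ¬-cong-⇔ ≡-injective

  samePair-injective : {x y p q : Fin m} → SamePair (f x) (f y) (f p) (f q) ⇔ SamePair x y p q
  samePair-injective = (≡-injective ×-⇔ ≡-injective) ⊎-⇔ (≡-injective ×-⇔ ≡-injective)

-- Every block is the image of this one under its `point` map, which turns
-- the per-block counts into closed computations on Fin 4.
canonical : NestedBlock 4
canonical = nb 0F 1F 2F 3F (λ ()) (λ ()) (λ ()) (λ ()) (λ ()) (λ ())

module _ {v : ℕ} (B : NestedBlock v) where

  point : Fin 4 → Fin v
  point 0F = a B
  point 1F = b B
  point 2F = c B
  point 3F = d B

  point-injective : Injective _≡_ _≡_ point
  point-injective {0F} {0F} _ = refl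
  point-injective {0F} {1F} e = contradiction e (a≢b B)
  point-injective {0F} {2F} e = contradiction e (a≢c B)
  point-injective {0F} {3F} e = contradiction e (a≢d B)
  point-injective {1F} {0F} e = contradiction (sym e) (a≢b B)
  point-injective {1F} {1F} _ = refl
  point-injective {1F} {2F} e = contradiction e (b≢c B)
  point-injective {1F} {3F} e = contradiction e (b≢d B)
  point-injective {2F} {0F} e = contradiction (sym e) (a≢c B)
  point-injective {2F} {1F} e = contradiction (sym e) (b≢c B)
  point-injective {2F} {2F} _ = refl
  point-injective {2F} {3F} e = contradiction e (c≢d B)
  point-injective {3F} {0F} e = contradiction (sym e) (a≢d B)
  point-injective {3F} {1F} e = contradiction (sym e) (b≢d B)
  point-injective {3F} {2F} e = contradiction (sym e) (c≢d B)
  point-injective {3F} {3F} _ = refl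

  pairOf-point : {i j : Fin 4} → PairOf B (point i) (point j) ⇔ PairOf canonical i j
  pairOf-point = samePair-injective point-injective ⊎-⇔ samePair-injective point-injective

  pairOf⇒∈B : {x y : Fin v} → PairOf B x y → x ∈B B × y ∈B B
  pairOf⇒∈B (inj₁ (inj₁ (refl , refl))) = inj₁ refl , inj₂ (inj₁ refl)
  pairOf⇒∈B (inj₁ (inj₂ (refl , refl))) = inj₂ (inj₁ refl) , inj₁ refl
  pairOf⇒∈B (inj₂ (inj₁ (refl , refl))) = inj₂ (inj₂ (inj₁ refl)) , inj₂ (inj₂ (inj₂ refl))
  pairOf⇒∈B (inj₂ (inj₂ (refl , refl))) = inj₂ (inj₂ (inj₂ refl)) , inj₂ (inj₂ (inj₁ refl))

  pairOf⇒≢ : {x y : Fin v} → PairOf B x y → x ≢ y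
  pairOf⇒≢ (inj₁ (inj₁ (refl , refl))) = a≢b B
  pairOf⇒≢ (inj₁ (inj₂ (refl , refl))) = a≢b B ∘ sym
  pairOf⇒≢ (inj₂ (inj₁ (refl , refl))) = c≢d B
  pairOf⇒≢ (inj₂ (inj₂ (refl , refl))) = c≢d B ∘ sym

  𝟙-∈B : (x : Fin v) → 𝟙 (x ∈B? B) ≡ ∑[ i < 4 ] 𝟙 (x ≟ point i)
  𝟙-∈B x = begin
    𝟙 (x≟a ⊎-dec x≟b ⊎-dec x≟c ⊎-dec x≟d)
      ≡⟨ 𝟙-⊎ x≟a (x≟b ⊎-dec x≟c ⊎-dec x≟d) (λ { refl → [ a≢b B , [ a≢c B , a≢d B ] ] }) ⟩
    𝟙 x≟a + 𝟙 (x≟b ⊎-dec x≟c ⊎-dec x≟d)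
      ≡⟨ cong (𝟙 x≟a +_) (𝟙-⊎ x≟b (x≟c ⊎-dec x≟d) (λ { refl → [ b≢c B , b≢d B ] })) ⟩
    𝟙 x≟a + (𝟙 x≟b + 𝟙 (x≟c ⊎-dec x≟d))
      ≡⟨ cong (λ s → 𝟙 x≟a + (𝟙 x≟b + s)) (𝟙-⊎ x≟c x≟d (λ { refl → c≢d B })) ⟩
    𝟙 x≟a + (𝟙 x≟b + (𝟙 x≟c + 𝟙 x≟d))
      ≡⟨ cong (λ s → 𝟙 x≟a + (𝟙 x≟b + (𝟙 x≟c + s))) (+-identityʳ (𝟙 x≟d)) ⟨
    ∑[ i < 4 ] 𝟙 (x ≟ point i) ∎
    where
    x≟a : Dec (x ≡ a B)
    x≟a = x ≟ a B
    x≟b : Dec (x ≡ b B)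
    x≟b = x ≟ b B
    x≟c : Dec (x ≡ c B)
    x≟c = x ≟ c B
    x≟d : Dec (x ≡ d B)
    x≟d = x ≟ d B

  ∑-∈B : (g : Fin v → ℕ) → ∑[ x < v ] (𝟙 (x ∈B? B) * g x) ≡ ∑[ i < 4 ] g (point i)
  ∑-∈B g = begin
    ∑[ x < v ] (𝟙 (x ∈B? B) * g x)
      ≡⟨ sum-cong-≗ (λ x → cong (_* g x) (𝟙-∈B x)) ⟩
    ∑[ x < v ] (∑[ i < 4 ] 𝟙 (x ≟ point i) * g x)
      ≡⟨ sum-cong-≗ (λ x → *-distribʳ-sum (g x) (λ i → 𝟙 (x ≟ point i))) ⟩
    ∑[ x < v ] ∑[ i < 4 ] (𝟙 (x ≟ point i) * g x)
      ≡⟨ ∑-comm (λ x i → 𝟙 (x ≟ point i) * g x) ⟩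
    ∑[ i < 4 ] ∑[ x < v ] (𝟙 (x ≟ point i) * g x)
      ≡⟨ sum-cong-≗ (λ i → ∑-δ (point i) g) ⟩
    ∑[ i < 4 ] g (point i) ∎

  ∑₂-∈B : (g : Fin v → Fin v → ℕ) →
          ∑[ x < v ] ∑[ y < v ] (𝟙 (x ∈B? B) * (𝟙 (y ∈B? B) * g x y)) ≡
          ∑[ i < 4 ] ∑[ j < 4 ] g (point i) (point j)
  ∑₂-∈B g = begin
    ∑[ x < v ] ∑[ y < v ] (𝟙 (x ∈B? B) * (𝟙 (y ∈B? B) * g x y))
      ≡⟨ sum-cong-≗ (λ x → *-distribˡ-sum (𝟙 (x ∈B? B)) (λ y → 𝟙 (y ∈B? B) * g x y)) ⟨
    ∑[ x < v ] (𝟙 (x ∈B? B) * ∑[ y < v ] (𝟙 (y ∈B? B) * g x y))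
      ≡⟨ ∑-∈B _ ⟩
    ∑[ i < 4 ] ∑[ y < v ] (𝟙 (y ∈B? B) * g (point i) y)
      ≡⟨ sum-cong-≗ (λ i → ∑-∈B (g (point i))) ⟩
    ∑[ i < 4 ] ∑[ j < 4 ] g (point i) (point j) ∎

  ∑₃-∈B : (g : Fin v → Fin v → Fin v → ℕ) →
          ∑[ x < v ] ∑[ y < v ] ∑[ z < v ] (𝟙 (x ∈B? B) * (𝟙 (y ∈B? B) * (𝟙 (z ∈B? B) * g x y z))) ≡
          ∑[ i < 4 ] ∑[ j < 4 ] ∑[ k < 4 ] g (point i) (point j) (point k)
  ∑₃-∈B g = begin
    ∑[ x < v ] ∑[ y < v ] ∑[ z < v ] (𝟙 (x ∈B? B) * (𝟙 (y ∈B? B) * (𝟙 (z ∈B? B) * g x y z)))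
      ≡⟨ ∑₂-cong (λ x y → pull (𝟙 (x ∈B? B)) (𝟙 (y ∈B? B)) (λ z → 𝟙 (z ∈B? B) * g x y z)) ⟩
    ∑[ x < v ] ∑[ y < v ] (𝟙 (x ∈B? B) * (𝟙 (y ∈B? B) * ∑[ z < v ] (𝟙 (z ∈B? B) * g x y z)))
      ≡⟨ ∑₂-∈B _ ⟩
    ∑[ i < 4 ] ∑[ j < 4 ] ∑[ z < v ] (𝟙 (z ∈B? B) * g (point i) (point j) z)
      ≡⟨ ∑₂-cong (λ i j → ∑-∈B (g (point i) (point j))) ⟩
    ∑[ i < 4 ] ∑[ j < 4 ] ∑[ k < 4 ] g (point i) (point j) (point k) ∎
    where
    pull : ∀ p q (h : Fin v → ℕ) → ∑[ z < v ] (p * (q * h z)) ≡ p * (q * sum h)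
    pull p q h = trans (sym (*-distribˡ-sum p (λ z → q * h z))) (cong (p *_) (sym (*-distribˡ-sum q h)))

  ∑-block-triples : ∑[ x < v ] ∑[ y < v ] ∑[ z < v ] (𝟙 (distinct₃? x y z) * 𝟙 (containsTriple? B x y z)) ≡ 24
  ∑-block-triples = begin
    ∑[ x < v ] ∑[ y < v ] ∑[ z < v ] (𝟙 (distinct₃? x y z) * 𝟙 (containsTriple? B x y z))
      ≡⟨ ∑₃-cong masked ⟩
    ∑[ x < v ] ∑[ y < v ] ∑[ z < v ] (𝟙 (x ∈B? B) * (𝟙 (y ∈B? B) * (𝟙 (z ∈B? B) * 𝟙 (distinct₃? x y z))))
      ≡⟨ ∑₃-∈B _ ⟩
    ∑[ i < 4 ] ∑[ j < 4 ] ∑[ k < 4 ] 𝟙 (distinct₃? (point i) (point j) (point k))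
      ≡⟨ ∑₃-cong (λ i j k → 𝟙-cong (distinct₃? (point i) (point j) (point k)) (distinct₃? i j k)
                                          (distinct₃-injective point-injective)) ⟩
    ∑[ i < 4 ] ∑[ j < 4 ] ∑[ k < 4 ] 𝟙 (distinct₃? i j k)
      ≡⟨⟩
    24 ∎
    where
    masked : ∀ x y z → 𝟙 (distinct₃? x y z) * 𝟙 (containsTriple? B x y z) ≡
                       𝟙 (x ∈B? B) * (𝟙 (y ∈B? B) * (𝟙 (z ∈B? B) * 𝟙 (distinct₃? x y z)))
    masked x y z = begin
      D * 𝟙 (containsTriple? B x y z)  ≡⟨ cong (D *_) (trans (𝟙-× (x ∈B? B) (y ∈B? B ×-dec z ∈B? B))
                                                             (cong (X *_) (𝟙-× (y ∈B? B) (z ∈B? B)))) ⟩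
      D * (X * (Y * Z))                ≡⟨ *-comm D (X * (Y * Z)) ⟩
      (X * (Y * Z)) * D                ≡⟨ *-assoc X (Y * Z) D ⟩
      X * ((Y * Z) * D)                ≡⟨ cong (X *_) (*-assoc Y Z D) ⟩
      X * (Y * (Z * D))                ∎
      where
      D = 𝟙 (distinct₃? x y z)
      X = 𝟙 (x ∈B? B)
      Y = 𝟙 (y ∈B? B)
      Z = 𝟙 (z ∈B? B)

  ∑-block-pairs : ∑[ x < v ] ∑[ y < v ] (𝟙 (¬? (x ≟ y)) * 𝟙 (pairOf? B x y)) ≡ 4
  ∑-block-pairs = begin
    ∑[ x < v ] ∑[ y < v ] (𝟙 (¬? (x ≟ y)) * 𝟙 (pairOf? B x y))
      ≡⟨ ∑₂-cong masked ⟩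
    ∑[ x < v ] ∑[ y < v ] (𝟙 (x ∈B? B) * (𝟙 (y ∈B? B) * 𝟙 (pairOf? B x y)))
      ≡⟨ ∑₂-∈B _ ⟩
    ∑[ i < 4 ] ∑[ j < 4 ] 𝟙 (pairOf? B (point i) (point j))
      ≡⟨ ∑₂-cong (λ i j → 𝟙-cong (pairOf? B (point i) (point j)) (pairOf? canonical i j) pairOf-point) ⟩
    ∑[ i < 4 ] ∑[ j < 4 ] 𝟙 (pairOf? canonical i j)
      ≡⟨⟩
    4 ∎
    where
    masked : ∀ x y → 𝟙 (¬? (x ≟ y)) * 𝟙 (pairOf? B x y) ≡ 𝟙 (x ∈B? B) * (𝟙 (y ∈B? B) * 𝟙 (pairOf? B x y))
    masked x y = begin
      𝟙 (¬? (x ≟ y)) * 𝟙 (pairOf? B x y)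
        ≡⟨ 𝟙-absorb (¬? (x ≟ y)) (pairOf? B x y) pairOf⇒≢ ⟩
      𝟙 (pairOf? B x y)
        ≡⟨ 𝟙-absorb (x ∈B? B) (pairOf? B x y) (proj₁ ∘ pairOf⇒∈B) ⟨
      𝟙 (x ∈B? B) * 𝟙 (pairOf? B x y)
        ≡⟨ cong (𝟙 (x ∈B? B) *_) (𝟙-absorb (y ∈B? B) (pairOf? B x y) (proj₂ ∘ pairOf⇒∈B)) ⟨
      𝟙 (x ∈B? B) * (𝟙 (y ∈B? B) * 𝟙 (pairOf? B x y)) ∎

module _ {v : ℕ} (ℬ : List (NestedBlock v)) where

  private
    block : Fin (length ℬ) → NestedBlock v
    block = lookup ℬ

  *-length-filter : ∀ w {P : NestedBlock v → Set} (P? : ∀ B → Dec (P B)) →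
                    w * length (filter P? ℬ) ≡ ∑[ i < length ℬ ] (w * 𝟙 (P? (block i)))
  *-length-filter w P? = trans (cong (w *_) (length-filter≡∑ P? ℬ)) (*-distribˡ-sum w (λ i → 𝟙 (P? (block i))))

  ∑-tripleCount : ∑[ x < v ] ∑[ y < v ] ∑[ z < v ] (𝟙 (distinct₃? x y z) * tripleCount ℬ x y z) ≡ length ℬ * 24
  ∑-tripleCount = begin
    ∑[ x < v ] ∑[ y < v ] ∑[ z < v ] (𝟙 (distinct₃? x y z) * tripleCount ℬ x y z)
      ≡⟨ ∑₃-cong (λ x y z → *-length-filter (𝟙 (distinct₃? x y z)) (λ B → containsTriple? B x y z)) ⟩
    ∑[ x < v ] ∑[ y < v ] ∑[ z < v ] ∑[ i < length ℬ ]
      (𝟙 (distinct₃? x y z) * 𝟙 (containsTriple? (block i) x y z))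
      ≡⟨ ∑₃-comm-∑ (λ x y z i → 𝟙 (distinct₃? x y z) * 𝟙 (containsTriple? (block i) x y z)) ⟩
    ∑[ i < length ℬ ] ∑[ x < v ] ∑[ y < v ] ∑[ z < v ]
      (𝟙 (distinct₃? x y z) * 𝟙 (containsTriple? (block i) x y z))
      ≡⟨ sum-cong-≗ (λ i → ∑-block-triples (block i)) ⟩
    ∑[ i < length ℬ ] 24
      ≡⟨ ∑-const (length ℬ) 24 ⟩
    length ℬ * 24 ∎

  ∑-multiplicity : ∑[ x < v ] ∑[ y < v ] (𝟙 (¬? (x ≟ y)) * multiplicity ℬ x y) ≡ length ℬ * 4
  ∑-multiplicity = begin
    ∑[ x < v ] ∑[ y < v ] (𝟙 (¬? (x ≟ y)) * multiplicity ℬ x y)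
      ≡⟨ ∑₂-cong (λ x y → *-length-filter (𝟙 (¬? (x ≟ y))) (λ B → pairOf? B x y)) ⟩
    ∑[ x < v ] ∑[ y < v ] ∑[ i < length ℬ ] (𝟙 (¬? (x ≟ y)) * 𝟙 (pairOf? (block i) x y))
      ≡⟨ ∑₂-comm-∑ (λ x y i → 𝟙 (¬? (x ≟ y)) * 𝟙 (pairOf? (block i) x y)) ⟩
    ∑[ i < length ℬ ] ∑[ x < v ] ∑[ y < v ] (𝟙 (¬? (x ≟ y)) * 𝟙 (pairOf? (block i) x y))
      ≡⟨ sum-cong-≗ (λ i → ∑-block-pairs (block i)) ⟩
    ∑[ i < length ℬ ] 4
      ≡⟨ ∑-const (length ℬ) 4 ⟩
    length ℬ * 4 ∎

module _ {n : ℕ} (ℬ : List (NestedBlock (2 + n))) where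

  nestedSQS-block-count : IsNestedSQS (2 + n) ℬ → (2 + n) * (suc n * n) ≡ length ℬ * 24
  nestedSQS-block-count (_ , sqs) = begin
    (2 + n) * (suc n * n)
      ≡⟨ ∑-distinct₃ {n} ⟨
    ∑[ x < 2 + n ] ∑[ y < 2 + n ] ∑[ z < 2 + n ] 𝟙 (distinct₃? x y z)
      ≡⟨ ∑₃-cong tripleCount≡1 ⟨
    ∑[ x < 2 + n ] ∑[ y < 2 + n ] ∑[ z < 2 + n ] (𝟙 (distinct₃? x y z) * tripleCount ℬ x y z)
      ≡⟨ ∑-tripleCount ℬ ⟩
    length ℬ * 24 ∎
    where
    tripleCount≡1 : ∀ x y z → 𝟙 (distinct₃? x y z) * tripleCount ℬ x y z ≡ 𝟙 (distinct₃? x y z)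
    tripleCount≡1 x y z = trans (𝟙-*-cong (distinct₃? x y z) (λ (x≢y , x≢z , y≢z) → sqs x y z x≢y x≢z y≢z))
                                (*-identityʳ _)

  constant-multiplicity-block-count : (∀ x y → x ≢ y → multiplicity ℬ x y ≡ m) →
                                      (2 + n) * (suc n * m) ≡ length ℬ * 4
  constant-multiplicity-block-count {m} multiplicity≡m = begin
    (2 + n) * (suc n * m)
      ≡⟨ ∑-distinct₂ {suc n} m ⟨
    ∑[ x < 2 + n ] ∑[ y < 2 + n ] (𝟙 (¬? (x ≟ y)) * m)
      ≡⟨ ∑₂-cong (λ x y → 𝟙-*-cong (¬? (x ≟ y)) (multiplicity≡m x y)) ⟨
    ∑[ x < 2 + n ] ∑[ y < 2 + n ] (𝟙 (¬? (x ≟ y)) * multiplicity ℬ x y)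
      ≡⟨ ∑-multiplicity ℬ ⟩
    length ℬ * 4 ∎

block-counts⇒n≡m*6 : ∀ n m b → (2 + n) * (suc n * n) ≡ b * 24 → (2 + n) * (suc n * m) ≡ b * 4 → n ≡ m * 6
block-counts⇒n≡m*6 n m b triples pairs = *-cancelˡ-≡ _ _ (suc n) (*-cancelˡ-≡ _ _ (2 + n) (begin
  (2 + n) * (suc n * n)         ≡⟨ triples ⟩
  b * 24                        ≡⟨ *-assoc b 4 6 ⟨
  b * 4 * 6                     ≡⟨ cong (_* 6) pairs ⟨
  (2 + n) * (suc n * m) * 6     ≡⟨ *-assoc (2 + n) (suc n * m) 6 ⟩
  (2 + n) * (suc n * m * 6)     ≡⟨ cong ((2 + n) *_) (*-assoc (suc n) m 6) ⟩
  (2 + n) * (suc n * (m * 6))   ∎))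

theorem4p1 : (v : ℕ) → 1 ≤ v → (ℬ : List (NestedBlock v)) →
    IsNestedSQS v ℬ → IsUniform ℬ →
    (∀ (x y : Fin v) → x ≢ y → IsNDPair ℬ x y) →
    (v % 6 ≡ 2) × (∀ (x y : Fin v) → x ≢ y → multiplicity ℬ x y ≡ (v ∸ 2) / 6)
theorem4p1 zero          ()
theorem4p1 1             _ _ (s≤s () , _)
theorem4p1 (suc (suc n)) _ ℬ sqs (m , uniform) allND = v%6≡2 , multiplicity≡[v∸2]/6
  where
  multiplicity≡m : ∀ x y → x ≢ y → multiplicity ℬ x y ≡ m
  multiplicity≡m x y x≢y = uniform x y x≢y (allND x y x≢y)

  n≡m*6 : n ≡ m * 6
  n≡m*6 = block-counts⇒n≡m*6 n m (length ℬ)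
            (nestedSQS-block-count ℬ sqs) (constant-multiplicity-block-count ℬ multiplicity≡m)

  v%6≡2 : (2 + n) % 6 ≡ 2
  v%6≡2 = trans (cong (λ k → (2 + k) % 6) n≡m*6) ([m+kn]%n≡m%n 2 m 6)

  multiplicity≡[v∸2]/6 : ∀ x y → x ≢ y → multiplicity ℬ x y ≡ n / 6
  multiplicity≡[v∸2]/6 x y x≢y = trans (multiplicity≡m x y x≢y) (sym (trans (cong (_/ 6) n≡m*6) (m*n/n≡m m 6)))
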